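{- Let $$A_n=\sum_{0\le j,k\le n}\binom{n}{j}^2\binom{n}{k}^2\binom{n+j}{n}\binom{n+k}{n}\binom{j+k}{n}$$ and $w_0(z)=\sum_{n\ge 0}A_n z^n\in\mathbb{Z}[[z]]$. Then for every integer $n\ge 1$, $v_2(A_n)\ge 2$. In particular $w_0(z)\equiv 1 \pmod 4$ (coefficientwise), and there exists $u_0(z)\in\mathbb{Z}[[z]]$ such that $w_0(z)=u_0(z)^2$.
   Context: $v_2$ denotes the $2$-adic valuation. Binomial coefficients $\binom{a}{b}$ with $b>a\ge 0$ are $0$. -}

module Defs where

open import Data.Nat using (ℕ; zero; suc; _+_; _*_; _∸_; _^_)
open import Data.Nat.Combinatorics using (_C_)
open import Data.Integer as ℤ using (ℤ; +_)

sumTo : ℕ → (ℕ → ℕ) → ℕ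
sumTo zero    f = f 0
sumTo (suc n) f = sumTo n f + f (suc n)

sumToℤ : ℕ → (ℕ → ℤ) → ℤ
sumToℤ zero    f = f 0
sumToℤ (suc n) f = sumToℤ n f ℤ.+ f (suc n)

-- A_n = Σ_{0≤j,k≤n} C(n,j)^2 C(n,k)^2 C(n+j,n) C(n+k,n) C(j+k,n)
-- (stdlib's  n C k  is 0 when k > n)
A : ℕ → ℕ
A n = sumTo n λ j → sumTo n λ k →
  (n C j) ^ 2 * (n C k) ^ 2 * ((n + j) C n) * ((n + k) C n) * ((j + k) C n)

PowerSeries : Set
PowerSeries = ℕ → ℤ

_*ₚ_ : PowerSeries → PowerSeries → PowerSeries
(f *ₚ g) n = sumToℤ n λ i → f i ℤ.* g (n ∸ i)

oneₚ : PowerSeries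
oneₚ zero    = + 1
oneₚ (suc n) = + 0

w₀ : PowerSeries
w₀ n = + A n

module Submission where

-- Write  a(n,j) = C(n,j)² C(n+j,n),  so that
--   A_n = Σ_{j,k ≤ n} a(n,j) a(n,k) C(j+k,n).
-- The trinomial revision  C(n+j,n) C(n,j) = C(2j,j) C(n+j,2j)  and the evenness
-- of the central binomial coefficient C(2j,j) (j ≥ 1) show that every weight
-- a(n,j) with j ≥ 1 is even.  The summand is symmetric in (j,k); for n ≥ 1 the
-- (0,0) term vanishes since C(0,n) = 0, the terms with exactly one index 0 pair
-- up into twice an even number, and the terms with j,k ≥ 1 are products of two
-- even weights.  Hence 4 ∣ A_n, i.e. w₀ = 1 + 4g with g(0) = 0.
-- Any such series is a square: solving  h + h² = g  coefficient by coefficient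
-- (h_n only involves h_1, …, h_{n-1}) gives  (1 + 2h)² = 1 + 4(h + h²) = w₀.

open import Defs
open import Data.Nat using (ℕ; zero; suc; _+_; _*_; _∸_; _^_; _≤_; z≤n; s≤s; _!; _≤?_)
open import Data.Nat.Properties
open import Data.Nat.Divisibility
open import Data.Nat.DivMod using (_/_; m/n*n≡m)
open import Data.Nat.Combinatorics
open import Data.Nat.Combinatorics.Specification using (nCk≡n!/k![n-k]!; k>n⇒nCk≡0)
import Data.Nat.Tactic.RingSolver as ℕ-Ring
open import Data.Nat.Solver using (module +-*-Solver)
open +-*-Solver using (solve; _:*_; _:^_; _:=_)
open import Data.Integer as ℤ using (ℤ; +_; _-_)
import Data.Integer.Properties as ℤ
open import Data.Integer.Divisibility as ℤD using ()
import Data.Integer.Tactic.RingSolver as ℤ-Ring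
open import Data.Product using (_×_; ∃; _,_)
open import Relation.Nullary using (yes; no)
open import Relation.Binary.PropositionalEquality
open ≡-Reasoning

sumTo-peel : ∀ m (f : ℕ → ℕ) → sumTo (suc m) f ≡ f 0 + sumTo m (λ i → f (suc i))
sumTo-peel zero    f = refl
sumTo-peel (suc m) f = begin
  sumTo (suc m) f + f (suc (suc m))                 ≡⟨ cong (_+ f (suc (suc m))) (sumTo-peel m f) ⟩
  f 0 + sumTo m (λ i → f (suc i)) + f (suc (suc m)) ≡⟨ +-assoc (f 0) _ _ ⟩
  f 0 + sumTo (suc m) (λ i → f (suc i))             ∎

sumTo-+ : ∀ m (f g : ℕ → ℕ) → sumTo m (λ i → f i + g i) ≡ sumTo m f + sumTo m g
sumTo-+ zero    f g = refl
sumTo-+ (suc m) f g = begin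
  sumTo m (λ i → f i + g i) + (f (suc m) + g (suc m)) ≡⟨ cong (_+ (f (suc m) + g (suc m))) (sumTo-+ m f g) ⟩
  sumTo m f + sumTo m g + (f (suc m) + g (suc m))     ≡⟨ +-interchange (sumTo m f) (sumTo m g) _ _ ⟩
  sumTo (suc m) f + sumTo (suc m) g                   ∎
  where
  +-interchange : ∀ a b c d → a + b + (c + d) ≡ a + c + (b + d)
  +-interchange = ℕ-Ring.solve-∀

sumTo-cong : ∀ m {f g : ℕ → ℕ} → (∀ i → f i ≡ g i) → sumTo m f ≡ sumTo m g
sumTo-cong zero    f≡g = f≡g 0
sumTo-cong (suc m) f≡g = cong₂ _+_ (sumTo-cong m f≡g) (f≡g (suc m))

sumTo-∣ : ∀ m {d} (f : ℕ → ℕ) → (∀ i → d ∣ f i) → d ∣ sumTo m f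
sumTo-∣ zero    f d∣f = d∣f 0
sumTo-∣ (suc m) f d∣f = ∣m∣n⇒∣m+n (sumTo-∣ m f d∣f) (d∣f (suc m))

sumTo²-symmetric : ∀ m (T : ℕ → ℕ → ℕ) → (∀ j k → T j k ≡ T k j) →
  sumTo (suc m) (λ j → sumTo (suc m) (T j))
    ≡ T 0 0 + 2 * sumTo m (λ k → T 0 (suc k))
            + sumTo m (λ j → sumTo m (λ k → T (suc j) (suc k)))
sumTo²-symmetric m T T-sym = begin
  sumTo (suc m) (λ j → sumTo (suc m) (T j))
    ≡⟨ sumTo-peel m _ ⟩
  sumTo (suc m) (T 0) + sumTo m (λ j → sumTo (suc m) (T (suc j)))
    ≡⟨ cong₂ _+_ (sumTo-peel m (T 0)) (sumTo-cong m (λ j → sumTo-peel m (T (suc j)))) ⟩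
  T 0 0 + Row + sumTo m (λ j → T (suc j) 0 + sumTo m (λ k → T (suc j) (suc k)))
    ≡⟨ cong (_+_ (T 0 0 + Row)) (sumTo-+ m _ _) ⟩
  T 0 0 + Row + (sumTo m (λ j → T (suc j) 0) + Inner)
    ≡⟨ cong (λ c → T 0 0 + Row + (c + Inner)) (sumTo-cong m (λ j → T-sym (suc j) 0)) ⟩
  T 0 0 + Row + (Row + Inner)
    ≡⟨ regroup (T 0 0) Row Inner ⟩
  T 0 0 + 2 * Row + Inner
    ∎
  where
  Row Inner : ℕ
  Row   = sumTo m (λ k → T 0 (suc k))
  Inner = sumTo m (λ j → sumTo m (λ k → T (suc j) (suc k)))
  regroup : ∀ a r s → a + r + (r + s) ≡ a + 2 * r + s
  regroup = ℕ-Ring.solve-∀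

4∣sumTo²-symmetric : ∀ m (T : ℕ → ℕ → ℕ) → (∀ j k → T j k ≡ T k j) →
  4 ∣ T 0 0 → (∀ k → 2 ∣ T 0 (suc k)) → (∀ j k → 4 ∣ T (suc j) (suc k)) →
  4 ∣ sumTo (suc m) (λ j → sumTo (suc m) (T j))
4∣sumTo²-symmetric m T T-sym 4∣corner 2∣row 4∣inner =
  subst (4 ∣_) (sym (sumTo²-symmetric m T T-sym))
    (∣m∣n⇒∣m+n (∣m∣n⇒∣m+n 4∣corner (*-monoʳ-∣ 2 (sumTo-∣ m _ 2∣row)))
               (sumTo-∣ m _ (λ j → sumTo-∣ m _ (4∣inner j))))

C*factorials : ∀ {n k r} → k ≤ n → n ∸ k ≡ r → (n C k) * (k ! * r !) ≡ n !
C*factorials {n} {k} k≤n refl = begin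
  (n C k) * (k ! * (n ∸ k) !)
    ≡⟨ cong (_* (k ! * (n ∸ k) !)) (nCk≡n!/k![n-k]! k≤n) ⟩
  (n ! / (k ! * (n ∸ k) !)) {{k !* (n ∸ k) !≢0}} * (k ! * (n ∸ k) !)
    ≡⟨ m/n*n≡m {{k !* (n ∸ k) !≢0}} (k![n∸k]!∣n! k≤n) ⟩
  n ! ∎

-- Trinomial revision: after multiplying by j! j! (n-j)!, both sides are (n+j)!.
trinomial-revision : ∀ n j → j ≤ n →
  ((n + j) C n) * (n C j) ≡ ((j + j) C j) * ((n + j) C (j + j))
trinomial-revision n j j≤n =
  *-cancelʳ-≡ _ _ (a * (a * b)) {{m*n≢0 _ _ {{j !≢0}} {{j !* (n ∸ j) !≢0}}}}
    (trans lhs≡[n+j]! (sym rhs≡[n+j]!))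
  where
  a b : ℕ
  a = j !
  b = (n ∸ j) !
  [n+j]Cn : ((n + j) C n) * (n ! * a) ≡ (n + j) !
  [n+j]Cn = C*factorials (m≤m+n n j) (m+n∸m≡n n j)
  [2j]Cj : ((j + j) C j) * (a * a) ≡ (j + j) !
  [2j]Cj = C*factorials (m≤m+n j j) (m+n∸n≡m j j)
  [n+j]C2j : ((n + j) C (j + j)) * ((j + j) ! * b) ≡ (n + j) !
  [n+j]C2j = C*factorials (+-monoˡ-≤ j j≤n)
    (trans (sym (∸-+-assoc (n + j) j j)) (cong (_∸ j) (m+n∸n≡m n j)))
  lhs≡[n+j]! : ((n + j) C n) * (n C j) * (a * (a * b)) ≡ (n + j) !
  lhs≡[n+j]! = begin
    ((n + j) C n) * (n C j) * (a * (a * b)) ≡⟨ shuffle ((n + j) C n) (n C j) a b ⟩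
    ((n + j) C n) * ((n C j) * (a * b) * a) ≡⟨ cong (λ t → ((n + j) C n) * (t * a)) (C*factorials j≤n refl) ⟩
    ((n + j) C n) * (n ! * a)               ≡⟨ [n+j]Cn ⟩
    (n + j) !                               ∎
    where
    shuffle : ∀ p q a b → p * q * (a * (a * b)) ≡ p * (q * (a * b) * a)
    shuffle = ℕ-Ring.solve-∀
  rhs≡[n+j]! : ((j + j) C j) * ((n + j) C (j + j)) * (a * (a * b)) ≡ (n + j) !
  rhs≡[n+j]! = begin
    ((j + j) C j) * ((n + j) C (j + j)) * (a * (a * b)) ≡⟨ shuffle ((j + j) C j) ((n + j) C (j + j)) a b ⟩
    ((n + j) C (j + j)) * (((j + j) C j) * (a * a) * b) ≡⟨ cong (λ t → ((n + j) C (j + j)) * (t * b)) [2j]Cj ⟩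
    ((n + j) C (j + j)) * ((j + j) ! * b)               ≡⟨ [n+j]C2j ⟩
    (n + j) !                                           ∎
    where
    shuffle : ∀ r s a b → r * s * (a * (a * b)) ≡ s * (r * (a * a) * b)
    shuffle = ℕ-Ring.solve-∀

-- The central binomial coefficient C(2j, j) is even for j ≥ 1, since by
-- Pascal's rule and symmetry  C(2m+2, m+1) = C(2m+1, m) + C(2m+1, m+1) = 2 C(2m+1, m).
central-binomial-even : ∀ m → 2 ∣ (suc m + suc m) C suc m
central-binomial-even m = divides (M C m) (begin
  suc M C suc m       ≡⟨ nCk+nC[k+1]≡[n+1]C[k+1] M m ⟨
  M C m + M C suc m   ≡⟨ cong (_+_ (M C m)) symmetric ⟩
  M C m + M C m       ≡⟨ +-*-2 (M C m) ⟩
  (M C m) * 2         ∎)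
  where
  M : ℕ
  M = m + suc m
  symmetric : M C suc m ≡ M C m
  symmetric = trans (nCk≡nC[n∸k] (m≤n+m (suc m) m)) (cong (M C_) (m+n∸n≡m m (suc m)))
  +-*-2 : ∀ x → x + x ≡ x * 2
  +-*-2 = ℕ-Ring.solve-∀

weight : ℕ → ℕ → ℕ
weight n j = (n C j) ^ 2 * ((n + j) C n)

-- For j ≥ 1 the weight is even: C(n+j,n) C(n,j) = C(2j,j) C(n+j,2j) if j ≤ n,
-- and C(n,j) = 0 otherwise.
weight-even : ∀ n j → 1 ≤ j → 2 ∣ weight n j
weight-even n j@(suc m) _ = subst (2 ∣_) (regroup (n C j) ((n + j) C n)) (∣n⇒∣m*n (n C j) even-product)
  where
  regroup : ∀ q p → q * (p * q) ≡ q ^ 2 * p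
  regroup = solve 2 (λ q p → q :* (p :* q) := q :^ 2 :* p) refl
  even-product : 2 ∣ ((n + j) C n) * (n C j)
  even-product with j ≤? n
  ... | yes j≤n = subst (2 ∣_) (sym (trinomial-revision n j j≤n))
          (∣m⇒∣m*n ((n + j) C (j + j)) (central-binomial-even m))
  ... | no  j≰n = subst (2 ∣_)
          (sym (trans (cong (((n + j) C n) *_) (k>n⇒nCk≡0 (≰⇒> j≰n))) (*-zeroʳ ((n + j) C n))))
          (2 ∣0)

A-summand : ℕ → ℕ → ℕ → ℕ
A-summand n j k = weight n j * weight n k * ((j + k) C n)

A-summand-symmetric : ∀ n j k → A-summand n j k ≡ A-summand n k j
A-summand-symmetric n j k = begin
  weight n j * weight n k * ((j + k) C n) ≡⟨ cong (λ t → weight n j * weight n k * (t C n)) (+-comm j k) ⟩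
  weight n j * weight n k * ((k + j) C n) ≡⟨ cong (_* ((k + j) C n)) (*-comm (weight n j) (weight n k)) ⟩
  weight n k * weight n j * ((k + j) C n) ∎

A≡sum-of-A-summands : ∀ n → A n ≡ sumTo n (λ j → sumTo n (A-summand n j))
A≡sum-of-A-summands n = sumTo-cong n (λ j → sumTo-cong n (λ k →
  regroup (n C j) (n C k) ((n + j) C n) ((n + k) C n) ((j + k) C n)))
  where
  regroup : ∀ qj qk pj pk c → qj ^ 2 * qk ^ 2 * pj * pk * c ≡ qj ^ 2 * pj * (qk ^ 2 * pk) * c
  regroup = solve 5 (λ qj qk pj pk c → qj :^ 2 :* qk :^ 2 :* pj :* pk :* c
                                    := qj :^ 2 :* pj :* (qk :^ 2 :* pk) :* c) refl

4∣A : ∀ n → 1 ≤ n → 2 ^ 2 ∣ A n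
4∣A (suc m) _ = subst (4 ∣_) (sym (A≡sum-of-A-summands (suc m)))
  (4∣sumTo²-symmetric m (A-summand (suc m)) (A-summand-symmetric (suc m))
    (∣n⇒∣m*n (weight n 0 * weight n 0) (4 ∣0))
    (λ k → ∣m⇒∣m*n _ (∣n⇒∣m*n (weight n 0) (weight-even n (suc k) (s≤s z≤n))))
    (λ j k → ∣m⇒∣m*n _ (*-pres-∣ (weight-even n (suc j) (s≤s z≤n)) (weight-even n (suc k) (s≤s z≤n)))))
  where
  n : ℕ
  n = suc m

sumToℤ-cong : ∀ n {f g : ℕ → ℤ} → (∀ i → i ≤ n → f i ≡ g i) → sumToℤ n f ≡ sumToℤ n g
sumToℤ-cong zero    f≡g = f≡g 0 z≤n
sumToℤ-cong (suc n) f≡g =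
  cong₂ ℤ._+_ (sumToℤ-cong n (λ i i≤n → f≡g i (m≤n⇒m≤1+n i≤n))) (f≡g (suc n) ≤-refl)

sumToℤ-vanishing : ∀ n (f : ℕ → ℤ) → (∀ i → i ≤ n → f i ≡ + 0) → sumToℤ n f ≡ + 0
sumToℤ-vanishing zero    f f≡0 = f≡0 0 z≤n
sumToℤ-vanishing (suc n) f f≡0 =
  cong₂ ℤ._+_ (sumToℤ-vanishing n f (λ i i≤n → f≡0 i (m≤n⇒m≤1+n i≤n))) (f≡0 (suc n) ≤-refl)

sumToℤ-linear : ∀ n (c : ℤ) (f g : ℕ → ℤ) →
  sumToℤ n (λ i → f i ℤ.+ c ℤ.* g i) ≡ sumToℤ n f ℤ.+ c ℤ.* sumToℤ n g
sumToℤ-linear zero    c f g = refl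
sumToℤ-linear (suc n) c f g = begin
  sumToℤ n (λ i → f i ℤ.+ c ℤ.* g i) ℤ.+ (f (suc n) ℤ.+ c ℤ.* g (suc n))
    ≡⟨ cong (ℤ._+ (f (suc n) ℤ.+ c ℤ.* g (suc n))) (sumToℤ-linear n c f g) ⟩
  sumToℤ n f ℤ.+ c ℤ.* sumToℤ n g ℤ.+ (f (suc n) ℤ.+ c ℤ.* g (suc n))
    ≡⟨ regroup (sumToℤ n f) (sumToℤ n g) (f (suc n)) (g (suc n)) c ⟩
  sumToℤ (suc n) f ℤ.+ c ℤ.* sumToℤ (suc n) g
    ∎
  where
  regroup : ∀ F G x y c → F ℤ.+ c ℤ.* G ℤ.+ (x ℤ.+ c ℤ.* y) ≡ F ℤ.+ x ℤ.+ c ℤ.* (G ℤ.+ y)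
  regroup = ℤ-Ring.solve-∀

*ₚ-identityˡ : ∀ f n → (oneₚ *ₚ f) n ≡ f n
*ₚ-identityˡ f n = select-first n (λ i → f (n ∸ i))
  where
  select-first : ∀ m (g : ℕ → ℤ) → sumToℤ m (λ i → oneₚ i ℤ.* g i) ≡ g 0
  select-first zero    g = ℤ.*-identityˡ (g 0)
  select-first (suc m) g = trans (cong (ℤ._+ (+ 0 ℤ.* g (suc m))) (select-first m g)) (ℤ.+-identityʳ (g 0))

*ₚ-identityʳ : ∀ f n → (f *ₚ oneₚ) n ≡ f n
*ₚ-identityʳ f zero    = ℤ.*-identityʳ (f 0)
*ₚ-identityʳ f (suc n) = begin
  sumToℤ n (λ i → f i ℤ.* oneₚ (suc n ∸ i)) ℤ.+ f (suc n) ℤ.* oneₚ (n ∸ n)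
    ≡⟨ cong₂ ℤ._+_ early-terms-vanish last-term ⟩
  + 0 ℤ.+ f (suc n)
    ≡⟨ ℤ.+-identityˡ (f (suc n)) ⟩
  f (suc n) ∎
  where
  early-terms-vanish : sumToℤ n (λ i → f i ℤ.* oneₚ (suc n ∸ i)) ≡ + 0
  early-terms-vanish = sumToℤ-vanishing n _ (λ i i≤n →
    trans (cong (λ t → f i ℤ.* oneₚ t) (+-∸-assoc 1 i≤n)) (ℤ.*-zeroʳ (f i)))
  last-term : f (suc n) ℤ.* oneₚ (n ∸ n) ≡ f (suc n)
  last-term = trans (cong (λ t → f (suc n) ℤ.* oneₚ t) (n∸n≡0 n)) (ℤ.*-identityʳ (f (suc n)))

*ₚ-expand : ∀ (a b x y : PowerSeries) (c d : ℤ) n →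
  ((λ i → a i ℤ.+ c ℤ.* x i) *ₚ (λ i → b i ℤ.+ d ℤ.* y i)) n
    ≡ (a *ₚ b) n ℤ.+ d ℤ.* (a *ₚ y) n ℤ.+ c ℤ.* (x *ₚ b) n ℤ.+ (c ℤ.* d) ℤ.* (x *ₚ y) n
*ₚ-expand a b x y c d n = begin
  sumToℤ n (λ i → (a i ℤ.+ c ℤ.* x i) ℤ.* (b (n ∸ i) ℤ.+ d ℤ.* y (n ∸ i)))
    ≡⟨ sumToℤ-cong n (λ i _ → expand (a i) (b (n ∸ i)) (x i) (y (n ∸ i)) c d) ⟩
  sumToℤ n (λ i → ab i ℤ.+ d ℤ.* ay i ℤ.+ c ℤ.* xb i ℤ.+ (c ℤ.* d) ℤ.* xy i)
    ≡⟨ sumToℤ-linear n (c ℤ.* d) _ xy ⟩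
  sumToℤ n (λ i → ab i ℤ.+ d ℤ.* ay i ℤ.+ c ℤ.* xb i) ℤ.+ (c ℤ.* d) ℤ.* (x *ₚ y) n
    ≡⟨ cong (ℤ._+ (c ℤ.* d) ℤ.* (x *ₚ y) n) (sumToℤ-linear n c _ xb) ⟩
  sumToℤ n (λ i → ab i ℤ.+ d ℤ.* ay i) ℤ.+ c ℤ.* (x *ₚ b) n ℤ.+ (c ℤ.* d) ℤ.* (x *ₚ y) n
    ≡⟨ cong (λ s → s ℤ.+ c ℤ.* (x *ₚ b) n ℤ.+ (c ℤ.* d) ℤ.* (x *ₚ y) n) (sumToℤ-linear n d ab ay) ⟩
  (a *ₚ b) n ℤ.+ d ℤ.* (a *ₚ y) n ℤ.+ c ℤ.* (x *ₚ b) n ℤ.+ (c ℤ.* d) ℤ.* (x *ₚ y) n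
    ∎
  where
  ab ay xb xy : ℕ → ℤ
  ab i = a i ℤ.* b (n ∸ i)
  ay i = a i ℤ.* y (n ∸ i)
  xb i = x i ℤ.* b (n ∸ i)
  xy i = x i ℤ.* y (n ∸ i)
  expand : ∀ a b x y c d → (a ℤ.+ c ℤ.* x) ℤ.* (b ℤ.+ d ℤ.* y)
    ≡ a ℤ.* b ℤ.+ d ℤ.* (a ℤ.* y) ℤ.+ c ℤ.* (x ℤ.* b) ℤ.+ (c ℤ.* d) ℤ.* (x ℤ.* y)
  expand = ℤ-Ring.solve-∀

1+2· : PowerSeries → PowerSeries
1+2· h i = oneₚ i ℤ.+ + 2 ℤ.* h i

square-of-1+2· : ∀ h n → (1+2· h *ₚ 1+2· h) n ≡ oneₚ n ℤ.+ + 4 ℤ.* (h n ℤ.+ (h *ₚ h) n)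
square-of-1+2· h n = begin
  (1+2· h *ₚ 1+2· h) n
    ≡⟨ *ₚ-expand oneₚ oneₚ h h (+ 2) (+ 2) n ⟩
  (oneₚ *ₚ oneₚ) n ℤ.+ + 2 ℤ.* (oneₚ *ₚ h) n ℤ.+ + 2 ℤ.* (h *ₚ oneₚ) n ℤ.+ + 4 ℤ.* (h *ₚ h) n
    ≡⟨ cong₂ (λ s t → s ℤ.+ + 2 ℤ.* t ℤ.+ + 2 ℤ.* (h *ₚ oneₚ) n ℤ.+ + 4 ℤ.* (h *ₚ h) n)
             (*ₚ-identityˡ oneₚ n) (*ₚ-identityˡ h n) ⟩
  oneₚ n ℤ.+ + 2 ℤ.* h n ℤ.+ + 2 ℤ.* (h *ₚ oneₚ) n ℤ.+ + 4 ℤ.* (h *ₚ h) n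
    ≡⟨ cong (λ t → oneₚ n ℤ.+ + 2 ℤ.* h n ℤ.+ + 2 ℤ.* t ℤ.+ + 4 ℤ.* (h *ₚ h) n) (*ₚ-identityʳ h n) ⟩
  oneₚ n ℤ.+ + 2 ℤ.* h n ℤ.+ + 2 ℤ.* h n ℤ.+ + 4 ℤ.* (h *ₚ h) n
    ≡⟨ collect (oneₚ n) (h n) ((h *ₚ h) n) ⟩
  oneₚ n ℤ.+ + 4 ℤ.* (h n ℤ.+ (h *ₚ h) n)
    ∎
  where
  collect : ∀ e x y → e ℤ.+ + 2 ℤ.* x ℤ.+ + 2 ℤ.* x ℤ.+ + 4 ℤ.* y ≡ e ℤ.+ + 4 ℤ.* (x ℤ.+ y)
  collect = ℤ-Ring.solve-∀

*ₚ-square-local : ∀ k (f g : PowerSeries) → f 0 ≡ + 0 → (∀ j → j ≤ k → f j ≡ g j) →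
  (f *ₚ f) (suc k) ≡ (g *ₚ g) (suc k)
*ₚ-square-local k f g f₀≡0 f≡g = sumToℤ-cong (suc k) same-term
  where
  g₀≡0 : g 0 ≡ + 0
  g₀≡0 = trans (sym (f≡g 0 z≤n)) f₀≡0
  same-term : ∀ i → i ≤ suc k → f i ℤ.* f (suc k ∸ i) ≡ g i ℤ.* g (suc k ∸ i)
  same-term zero    _ rewrite f₀≡0 | g₀≡0 = refl
  same-term (suc i) (s≤s i≤k) with k ∸ i in k∸i≡
  ... | zero rewrite f₀≡0 | g₀≡0 = trans (ℤ.*-zeroʳ (f (suc i))) (sym (ℤ.*-zeroʳ (g (suc i))))
  ... | suc r = cong₂ ℤ._*_ (f≡g (suc i) 1+i≤k) (f≡g (suc r) 1+r≤k)
    where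
    1+i≤k : suc i ≤ k
    1+i≤k = m∸n≢0⇒n<m (λ k∸i≡0 → 0≢1+n (trans (sym k∸i≡0) k∸i≡))
    1+r≤k : suc r ≤ k
    1+r≤k = subst (_≤ k) k∸i≡ (m∸n≤m k i)

-- Since h(0) = 0, the degree-(k+1)
-- coefficient of h² only involves h_1, …, h_k, so we may put
-- h_{k+1} = g_{k+1} - (h²)_{k+1}.  This recursion is realised by the
-- approximants below, the approximant with fuel f being correct in degrees ≤ f.
module QuadraticSolution (g : PowerSeries) where

  approximant : ℕ → PowerSeries
  approximant _          zero    = + 0
  approximant zero       (suc n) = + 0
  approximant (suc fuel) (suc n) = g (suc n) - (approximant fuel *ₚ approximant fuel) (suc n)

  approximant-stable : ∀ a b n → n ≤ a → n ≤ b → approximant a n ≡ approximant b n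
  approximant-stable a       b       zero    _         _         = refl
  approximant-stable (suc a) (suc b) (suc k) (s≤s k≤a) (s≤s k≤b) =
    cong (g (suc k) -_) (*ₚ-square-local k (approximant a) (approximant b) refl
      (λ j j≤k → approximant-stable a b j (≤-trans j≤k k≤a) (≤-trans j≤k k≤b)))

  solution : PowerSeries
  solution n = approximant n n

  solution-equation : g 0 ≡ + 0 → ∀ n → solution n ℤ.+ (solution *ₚ solution) n ≡ g n
  solution-equation g₀≡0 zero    = sym g₀≡0
  solution-equation _    (suc k) = begin
    g (suc k) - (approximant k *ₚ approximant k) (suc k) ℤ.+ (solution *ₚ solution) (suc k)
      ≡⟨ cong (λ s → g (suc k) - s ℤ.+ (solution *ₚ solution) (suc k))
              (*ₚ-square-local k (approximant k) solution refl
                 (λ j j≤k → approximant-stable k j j j≤k ≤-refl)) ⟩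
    g (suc k) - (solution *ₚ solution) (suc k) ℤ.+ (solution *ₚ solution) (suc k)
      ≡⟨ cancel (g (suc k)) ((solution *ₚ solution) (suc k)) ⟩
    g (suc k) ∎
    where
    cancel : ∀ a b → a - b ℤ.+ b ≡ a
    cancel = ℤ-Ring.solve-∀

square-root-of-1+4· : ∀ g → g 0 ≡ + 0 →
  ∃ λ (u : PowerSeries) → ∀ n → (u *ₚ u) n ≡ oneₚ n ℤ.+ + 4 ℤ.* g n
square-root-of-1+4· g g₀≡0 = 1+2· solution , λ n → begin
  (1+2· solution *ₚ 1+2· solution) n                  ≡⟨ square-of-1+2· solution n ⟩
  oneₚ n ℤ.+ + 4 ℤ.* (solution n ℤ.+ (solution *ₚ solution) n) ≡⟨ cong (λ t → oneₚ n ℤ.+ + 4 ℤ.* t) (solution-equation g₀≡0 n) ⟩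
  oneₚ n ℤ.+ + 4 ℤ.* g n                              ∎
  where open QuadraticSolution g

w₀-quarter : PowerSeries
w₀-quarter zero    = + 0
w₀-quarter (suc m) = + quotient (4∣A (suc m) (s≤s z≤n))

w₀≡1+4· : ∀ n → w₀ n ≡ oneₚ n ℤ.+ + 4 ℤ.* w₀-quarter n
w₀≡1+4· zero    = refl
w₀≡1+4· (suc m) = begin
  + A (suc m)           ≡⟨ cong +_ (trans (_∣_.equality 4∣Aₙ) (*-comm q 4)) ⟩
  + (4 * q)             ≡⟨ ℤ.pos-* 4 q ⟩
  + 4 ℤ.* + q           ≡⟨ ℤ.+-identityˡ (+ 4 ℤ.* + q) ⟨
  + 0 ℤ.+ + 4 ℤ.* + q   ∎
  where
  4∣Aₙ : 4 ∣ A (suc m)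
  4∣Aₙ = 4∣A (suc m) (s≤s z≤n)
  q : ℕ
  q = quotient 4∣Aₙ

w₀≡1-mod-4 : ∀ n → + 4 ℤD.∣ (w₀ n - oneₚ n)
w₀≡1-mod-4 n = subst (+ 4 ℤD.∣_) (sym w₀-1≡4·) (ℤD.*-monoʳ-∣ (+ 4) {+ 1} {w₀-quarter n} (1∣ ℤ.∣ w₀-quarter n ∣))
  where
  w₀-1≡4· : w₀ n - oneₚ n ≡ + 4 ℤ.* w₀-quarter n
  w₀-1≡4· = trans (cong (_- oneₚ n) (w₀≡1+4· n)) (cancel (oneₚ n) (+ 4 ℤ.* w₀-quarter n))
    where
    cancel : ∀ a b → a ℤ.+ b - a ≡ b
    cancel = ℤ-Ring.solve-∀

w₀-is-a-square : ∃ (λ (u₀ : PowerSeries) → (n : ℕ) → (u₀ *ₚ u₀) n ≡ w₀ n)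
w₀-is-a-square with square-root-of-1+4· w₀-quarter refl
... | u₀ , u₀²≡1+4g = u₀ , λ n → trans (u₀²≡1+4g n) (sym (w₀≡1+4· n))

mainTheorem2 : ((n : ℕ) → 1 ≤ n → 2 ^ 2 ∣ A n)
               × ((n : ℕ) → (+ 4) ℤD.∣ (w₀ n - oneₚ n))
               × ∃ (λ (u₀ : PowerSeries) → (n : ℕ) → (u₀ *ₚ u₀) n ≡ w₀ n)
mainTheorem2 = 4∣A , w₀≡1-mod-4 , w₀-is-a-square
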